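{- Let $b$ be a positive integer. A $b$-colored partition of $n$ into distinct parts is a finite set of colored parts $r_c$ ($r\ge1$, $c\in\{1,\dots,b\}$), each colored part occurring at most once (parts of equal size but different colors are considered distinct), whose sizes sum to $n$. Let $F^d_k(n)$ be the total number of parts of size $k$ (of any color) in all $b$-colored partitions of $n$ into distinct parts. Consider also $b$-colored partitions of $n$ into odd parts: finite multisets of colored parts $r_c$ with $r$ odd and $c\in\{1,\dots,b\}$ whose sizes (with multiplicity) sum to $n$; for such a partition $\pi$ let $g^o_k(\pi)$ be the number of distinct colored parts $r_c$ occurring at least $k$ times in $\pi$, and let $G^o_k(n)=\sum_\pi g^o_k(\pi)$ over all $b$-colored partitions $\pi$ of $n$ into odd parts, with $G^o_k(m)=0$ for $m\le0$. Then for all positive integers $n$ and all $k=1,2,3,\dots$, $$F^d_k(n)=G^o_k(n)-G^o_k(n-k).$$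
   Context: For example, with $b=2$, $3_1+3_2+5_2$ is a $2$-colored partition of $11$ into distinct parts, contributing $2$ to $F^d_3(11)$. -}

module Defs where

open import Data.Nat using (ℕ; zero; suc; _+_; _*_; _≤_; _≤?_; _≟_)
open import Data.Fin using (Fin; toℕ)
open import Data.Bool using (Bool; true; false)
open import Data.List using (List; []; _∷_; map; concatMap; filter; upTo; allFin; length)
open import Data.Nat.ListAction using (sum)
open import Data.Product using (_×_; _,_)
open import Data.Integer using (ℤ; +_; -[1+_])
open import Relation.Nullary.Decidable using (⌊_⌋)

allFuns : {A : Set} → (m : ℕ) → List A → List (Fin m → A)
allFuns zero    xs = (λ ()) ∷ []
allFuns (suc m) xs =
  concatMap (λ x → map (λ f → λ { Fin.zero → x ; (Fin.suc i) → f i }) (allFuns m xs)) xs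

ΣFin : (m : ℕ) → (Fin m → ℕ) → ℕ
ΣFin m f = sum (map f (allFin m))

ind : Bool → ℕ
ind true  = 1
ind false = 0

-- A colored part r_c with r ≤ n is indexed by (i , c) : Fin n × Fin b with
-- r = suc (toℕ i).  (Parts larger than n cannot occur in a partition of n.)
-- A distinct-part partition is the indicator function of its set of parts.

DistinctCand : ℕ → ℕ → Set
DistinctCand n b = Fin n → Fin b → Bool

dSize : (n b : ℕ) → DistinctCand n b → ℕ
dSize n b f = ΣFin n (λ i → ΣFin b (λ c → suc (toℕ i) * ind (f i c)))

distinctPartitions : (n b : ℕ) → List (DistinctCand n b)
distinctPartitions n b =
  filter (λ f → dSize n b f ≟ n) (allFuns n (allFuns b (false ∷ true ∷ [])))

partsOfSize : (n b : ℕ) → ℕ → DistinctCand n b → ℕ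
partsOfSize n b k f =
  ΣFin n (λ i → ΣFin b (λ c → ind (f i c) * ind ⌊ suc (toℕ i) ≟ k ⌋))

Fd : (b k n : ℕ) → ℕ
Fd b k n = sum (map (partsOfSize n b k) (distinctPartitions n b))

-- The odd colored part (2j+1)_c with 2j+1 ≤ 2n-1 is indexed by (j , c) : Fin n × Fin b.
-- A partition is its multiplicity function; multiplicities are at most n.

OddCand : ℕ → ℕ → Set
OddCand n b = Fin n → Fin b → ℕ

oSize : (n b : ℕ) → OddCand n b → ℕ
oSize n b m = ΣFin n (λ j → ΣFin b (λ c → suc (2 * toℕ j) * m j c))

oddPartitions : (n b : ℕ) → List (OddCand n b)
oddPartitions n b =
  filter (λ m → oSize n b m ≟ n) (allFuns n (allFuns b (upTo (suc n))))

go : (n b k : ℕ) → OddCand n b → ℕ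
go n b k m = ΣFin n (λ j → ΣFin b (λ c → ind ⌊ k ≤? m j c ⌋))

Go : (b k n : ℕ) → ℕ
Go b k n = sum (map (go n b k) (oddPartitions n b))

Goℤ : (b k : ℕ) → ℤ → ℤ
Goℤ b k (+ zero)    = + 0
Goℤ b k (+ (suc m)) = + Go b k (suc m)
Goℤ b k -[1+ m ]    = + 0

-- Compare generating functions truncated at degree n. Marking the parts of size k in
-- D(q) = ∏ᵢ (1 + qⁱ)^b gives b q^k D(q)/(1 + q^k), and marking the coloured odd parts of multiplicity
-- at least k in O(q) = ∏ⱼ (1 - q^{2j+1})^{-b} gives b q^k O(q)/(1 - q^{2k}). Euler's identity D = O
-- makes the first series (1 - q^k) times the second, which is the claim read off coefficientwise.

module Submission where

open import Data.Nat using (ℕ; zero; suc; _+_; _*_; _∸_; _≤_; _<_; z≤n; s≤s; s≤s⁻¹; _≤?_; _≟_; ⌊_/2⌋; ⌈_/2⌉)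
open import Data.Nat.Properties
open import Data.Nat.Tactic.RingSolver using (solve-∀)
open import Data.Nat.ListAction using (sum)
open import Data.Integer using (+_; -[1+_]; _-_; -_)
open import Data.Integer.Properties using ([+m]-[+n]≡m⊖n; ⊖-≥; ⊖-<)
open import Data.Fin using (Fin; toℕ)
open import Data.Bool using (Bool; true; false)
open import Data.List using (List; []; _∷_; _++_; map; concatMap; replicate; upTo; applyUpTo; filter)
open import Data.List.Properties using (map-tabulate; filter-accept; filter-reject)
open import Data.Product using (Σ; _×_; _,_)
open import Data.Empty using (⊥-elim)
open import Relation.Binary.PropositionalEquality
open import Relation.Nullary using (yes; no)
open import Relation.Nullary.Decidable using (⌊_⌋)
open import Function using (_∘_; id)
open import Defs

∑ : {A : Set} → List A → (A → ℕ) → ℕ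
∑ []       f = 0
∑ (x ∷ xs) f = f x + ∑ xs f

module _ {A : Set} where
  ∑-++ : (xs ys : List A) (f : A → ℕ) → ∑ (xs ++ ys) f ≡ ∑ xs f + ∑ ys f
  ∑-++ []       ys f = refl
  ∑-++ (x ∷ xs) ys f rewrite ∑-++ xs ys f = sym (+-assoc (f x) _ _)

  ∑-cong : (xs : List A) {f g : A → ℕ} → (∀ x → f x ≡ g x) → ∑ xs f ≡ ∑ xs g
  ∑-cong []       e = refl
  ∑-cong (x ∷ xs) e = cong₂ _+_ (e x) (∑-cong xs e)

  ∑-+ : (xs : List A) (f g : A → ℕ) → ∑ xs (λ x → f x + g x) ≡ ∑ xs f + ∑ xs g
  ∑-+ []       f g = refl
  ∑-+ (x ∷ xs) f g rewrite ∑-+ xs f g = interchange (f x) (g x) (∑ xs f) (∑ xs g)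
    where
    interchange : ∀ a b c d → (a + b) + (c + d) ≡ (a + c) + (b + d)
    interchange = solve-∀

  ∑-*ˡ : (xs : List A) (c : ℕ) (f : A → ℕ) → ∑ xs (λ x → c * f x) ≡ c * ∑ xs f
  ∑-*ˡ []       c f = sym (*-zeroʳ c)
  ∑-*ˡ (x ∷ xs) c f rewrite ∑-*ˡ xs c f = sym (*-distribˡ-+ c (f x) (∑ xs f))

  ∑-*ˡ-+ : (xs : List A) (a : ℕ) (V H : A → ℕ) →
    a * ∑ xs H + ∑ xs (λ x → V x * H x) ≡ ∑ xs (λ x → (a + V x) * H x)
  ∑-*ˡ-+ xs a V H = begin
    a * ∑ xs H + ∑ xs (λ x → V x * H x)            ≡⟨ cong (_+ _) (∑-*ˡ xs a H) ⟨
    ∑ xs (λ x → a * H x) + ∑ xs (λ x → V x * H x)  ≡⟨ ∑-+ xs _ _ ⟨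
    ∑ xs (λ x → a * H x + V x * H x)               ≡⟨ ∑-cong xs (λ x → *-distribʳ-+ (H x) a (V x)) ⟨
    ∑ xs (λ x → (a + V x) * H x)                   ∎
    where open ≡-Reasoning

  ∑-zero : (xs : List A) {f : A → ℕ} → (∀ x → f x ≡ 0) → ∑ xs f ≡ 0
  ∑-zero []       e = refl
  ∑-zero (x ∷ xs) e rewrite e x = ∑-zero xs e

  ∑-replicate : (w : ℕ) (a : A) (f : A → ℕ) → ∑ (replicate w a) f ≡ w * f a
  ∑-replicate zero    a f = refl
  ∑-replicate (suc w) a f rewrite ∑-replicate w a f = refl

module _ {A B : Set} where
  ∑-map : (g : A → B) (xs : List A) (f : B → ℕ) → ∑ (map g xs) f ≡ ∑ xs (f ∘ g)
  ∑-map g []       f = refl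
  ∑-map g (x ∷ xs) f rewrite ∑-map g xs f = refl

  ∑-concatMap : (g : A → List B) (xs : List A) (f : B → ℕ) →
    ∑ (concatMap g xs) f ≡ ∑ xs (λ x → ∑ (g x) f)
  ∑-concatMap g []       f = refl
  ∑-concatMap g (x ∷ xs) f rewrite ∑-++ (g x) (concatMap g xs) f | ∑-concatMap g xs f = refl

  ∑-comm : (xs : List A) (ys : List B) (f : A → B → ℕ) →
    ∑ xs (λ x → ∑ ys (f x)) ≡ ∑ ys (λ y → ∑ xs (λ x → f x y))
  ∑-comm []       ys f = sym (∑-zero ys (λ _ → refl))
  ∑-comm (x ∷ xs) ys f rewrite ∑-comm xs ys f = sym (∑-+ ys (f x) (λ y → ∑ xs (λ x → f x y)))

∑-filter : {A : Set} (xs : List A) (size weight : A → ℕ) (n : ℕ) →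
  sum (map weight (filter (λ x → size x ≟ n) xs)) ≡ ∑ xs (λ x → weight x * ind ⌊ size x ≟ n ⌋)
∑-filter []       size weight n = refl
∑-filter (x ∷ xs) size weight n with size x ≟ n
... | yes e rewrite filter-accept (λ y → size y ≟ n) {x} {xs} e =
  cong₂ _+_ (sym (*-identityʳ (weight x))) (∑-filter xs size weight n)
... | no ne rewrite filter-reject (λ y → size y ≟ n) {x} {xs} ne =
  trans (∑-filter xs size weight n)
        (cong (_+ ∑ xs (λ y → weight y * ind ⌊ size y ≟ n ⌋)) (sym (*-zeroʳ (weight x))))

ΣFin-suc : ∀ m (f : Fin (suc m) → ℕ) → ΣFin (suc m) f ≡ f Fin.zero + ΣFin m (f ∘ Fin.suc)
ΣFin-suc m f = cong (λ l → sum (f Fin.zero ∷ l))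
  (trans (map-tabulate Fin.suc f) (sym (map-tabulate id (f ∘ Fin.suc))))

∑-allFuns-suc : {A : Set} (m : ℕ) (xs : List A) (F : A → (Fin m → A) → ℕ) →
  ∑ (allFuns (suc m) xs) (λ f → F (f Fin.zero) (f ∘ Fin.suc)) ≡ ∑ xs (λ x → ∑ (allFuns m xs) (F x))
∑-allFuns-suc m xs F =
  trans (∑-concatMap _ xs _) (∑-cong xs (λ x → ∑-map _ (allFuns m xs) _))

-- Polynomials over ℕ, compared up to a degree

-- A polynomial with coefficients in ℕ is the list of its exponents, each repeated as often as its coefficient.
Poly : Set
Poly = List ℕ

infixr 9 q^_ 1+q^_
infixr 7 _⊗_

q^_ : ℕ → Poly
q^ c = c ∷ []

one : Poly
one = q^ 0

1+q^_ : ℕ → Poly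
1+q^ s = 0 ∷ s ∷ []

scalar : ℕ → Poly
scalar b = replicate b 0

opaque
  _⊗_ : Poly → Poly → Poly
  P ⊗ Q = concatMap (λ x → map (_+_ x) Q) P

  ∑-⊗ : (P Q : Poly) (f : ℕ → ℕ) → ∑ (P ⊗ Q) f ≡ ∑ P (λ x → ∑ Q (λ y → f (x + y)))
  ∑-⊗ P Q f = trans (∑-concatMap _ P f) (∑-cong P (λ x → ∑-map (_+_ x) Q f))

∑-q^⊗ : ∀ c X f → ∑ (q^ c ⊗ X) f ≡ ∑ X (λ y → f (c + y))
∑-q^⊗ c X f = trans (∑-⊗ (q^ c) X f) (+-identityʳ _)

∑-scalar⊗ : ∀ b X f → ∑ (scalar b ⊗ X) f ≡ b * ∑ X f
∑-scalar⊗ b X f = trans (∑-⊗ (scalar b) X f) (∑-replicate b 0 _)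

VanishAbove : ℕ → (ℕ → ℕ) → Set
VanishAbove N h = ∀ m → N < m → h m ≡ 0

-- Agreement in the coefficients of q⁰, …, q^N, tested against every weighting of the exponents vanishing above N.
infix 4 _≈[_]_
record _≈[_]_ (P : Poly) (N : ℕ) (Q : Poly) : Set where
  constructor mk≈
  field run : ∀ h → VanishAbove N h → ∑ P h ≡ ∑ Q h
open _≈[_]_ public

≡⇒≈ : ∀ {N P Q} → P ≡ Q → P ≈[ N ] Q
≡⇒≈ refl = mk≈ λ _ _ → refl

≈-refl : ∀ {P N} → P ≈[ N ] P
≈-refl = ≡⇒≈ refl

≈-sym : ∀ {P Q N} → P ≈[ N ] Q → Q ≈[ N ] P
≈-sym e = mk≈ λ h v → sym (run e h v)

≈-trans : ∀ {P Q R N} → P ≈[ N ] Q → Q ≈[ N ] R → P ≈[ N ] R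
≈-trans e f = mk≈ λ h v → trans (run e h v) (run f h v)

infixr 2 _≈⟨_⟩_
infix 3 _∎≈
_≈⟨_⟩_ : ∀ {Q R N} P → P ≈[ N ] Q → Q ≈[ N ] R → P ≈[ N ] R
P ≈⟨ e ⟩ f = ≈-trans e f
_∎≈ : ∀ {N} P → P ≈[ N ] P
P ∎≈ = ≈-refl

VanishAbove-shift : ∀ {N h} x → VanishAbove N h → VanishAbove N (λ y → h (x + y))
VanishAbove-shift {N} x v m N<m = v (x + m) (≤-trans N<m (m≤n+m m x))

coeff : ℕ → Poly → ℕ
coeff m P = ∑ P (λ a → ind ⌊ a ≟ m ⌋)

coeff-≈ : ∀ {m N P Q} → m ≤ N → P ≈[ N ] Q → coeff m P ≡ coeff m Q
coeff-≈ {m} m≤N e = run e _ vanish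
  where
  vanish : VanishAbove _ (λ a → ind ⌊ a ≟ m ⌋)
  vanish a N<a with a ≟ m
  ... | yes refl = ⊥-elim (<⇒≱ N<a m≤N)
  ... | no _     = refl

coeff-q^⊗ : ∀ c X {m} → c ≤ m → coeff m (q^ c ⊗ X) ≡ coeff (m ∸ c) X
coeff-q^⊗ c X {m} c≤m = trans (∑-q^⊗ c X _) (∑-cong X shift)
  where
  shift : ∀ y → ind ⌊ c + y ≟ m ⌋ ≡ ind ⌊ y ≟ m ∸ c ⌋
  shift y with c + y ≟ m | y ≟ m ∸ c
  ... | yes _  | yes _  = refl
  ... | no _   | no _   = refl
  ... | yes e  | no ne  = ⊥-elim (ne (trans (sym (m+n∸m≡n c y)) (cong (_∸ c) e)))
  ... | no ne  | yes e  = ⊥-elim (ne (trans (cong (_+_ c) e) (m+[n∸m]≡n c≤m)))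

module _ {N : ℕ} where
  ⊗-comm : ∀ P Q → P ⊗ Q ≈[ N ] Q ⊗ P
  ⊗-comm P Q .run h v = begin
    ∑ (P ⊗ Q) h                          ≡⟨ ∑-⊗ P Q h ⟩
    ∑ P (λ x → ∑ Q (λ y → h (x + y)))    ≡⟨ ∑-comm P Q _ ⟩
    ∑ Q (λ y → ∑ P (λ x → h (x + y)))    ≡⟨ ∑-cong Q (λ y → ∑-cong P (λ x → cong h (+-comm x y))) ⟩
    ∑ Q (λ y → ∑ P (λ x → h (y + x)))    ≡⟨ ∑-⊗ Q P h ⟨
    ∑ (Q ⊗ P) h                          ∎
    where open ≡-Reasoning

  ⊗-assoc : ∀ P Q R → (P ⊗ Q) ⊗ R ≈[ N ] P ⊗ (Q ⊗ R)
  ⊗-assoc P Q R .run h v = begin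
    ∑ ((P ⊗ Q) ⊗ R) h                                         ≡⟨ ∑-⊗ (P ⊗ Q) R h ⟩
    ∑ (P ⊗ Q) (λ w → ∑ R (λ z → h (w + z)))                   ≡⟨ ∑-⊗ P Q _ ⟩
    ∑ P (λ x → ∑ Q (λ y → ∑ R (λ z → h ((x + y) + z))))       ≡⟨ ∑-cong P (λ x → ∑-cong Q (λ y →
                                                                   ∑-cong R (λ z → cong h (+-assoc x y z)))) ⟩
    ∑ P (λ x → ∑ Q (λ y → ∑ R (λ z → h (x + (y + z)))))       ≡⟨ ∑-cong P (λ x → ∑-⊗ Q R (λ w → h (x + w))) ⟨
    ∑ P (λ x → ∑ (Q ⊗ R) (λ w → h (x + w)))                   ≡⟨ ∑-⊗ P (Q ⊗ R) h ⟨
    ∑ (P ⊗ (Q ⊗ R)) h                                         ∎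
    where open ≡-Reasoning

  ⊗-congʳ : ∀ P {Q Q'} → Q ≈[ N ] Q' → P ⊗ Q ≈[ N ] P ⊗ Q'
  ⊗-congʳ P {Q} {Q'} e .run h v = begin
    ∑ (P ⊗ Q) h                          ≡⟨ ∑-⊗ P Q h ⟩
    ∑ P (λ x → ∑ Q (λ y → h (x + y)))    ≡⟨ ∑-cong P (λ x → run e _ (VanishAbove-shift x v)) ⟩
    ∑ P (λ x → ∑ Q' (λ y → h (x + y)))   ≡⟨ ∑-⊗ P Q' h ⟨
    ∑ (P ⊗ Q') h                         ∎
    where open ≡-Reasoning

  ⊗-congˡ : ∀ {P P'} Q → P ≈[ N ] P' → P ⊗ Q ≈[ N ] P' ⊗ Q
  ⊗-congˡ {P} {P'} Q e =
    P ⊗ Q   ≈⟨ ⊗-comm P Q ⟩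
    Q ⊗ P   ≈⟨ ⊗-congʳ Q e ⟩
    Q ⊗ P'  ≈⟨ ⊗-comm Q P' ⟩
    P' ⊗ Q  ∎≈

  ⊗-cong : ∀ {P P' Q Q'} → P ≈[ N ] P' → Q ≈[ N ] Q' → P ⊗ Q ≈[ N ] P' ⊗ Q'
  ⊗-cong {P' = P'} {Q = Q} e f = ≈-trans (⊗-congˡ Q e) (⊗-congʳ P' f)

  ++-cong : ∀ {P P' Q Q'} → P ≈[ N ] P' → Q ≈[ N ] Q' → P ++ Q ≈[ N ] P' ++ Q'
  ++-cong {P} {P'} {Q} {Q'} e f .run h v rewrite ∑-++ P Q h | ∑-++ P' Q' h =
    cong₂ _+_ (run e h v) (run f h v)

  ++-comm : ∀ P Q → P ++ Q ≈[ N ] Q ++ P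
  ++-comm P Q .run h v rewrite ∑-++ P Q h | ∑-++ Q P h = +-comm (∑ P h) (∑ Q h)

  ++-assoc : ∀ P Q R → (P ++ Q) ++ R ≈[ N ] P ++ (Q ++ R)
  ++-assoc P Q R .run h v rewrite ∑-++ (P ++ Q) R h | ∑-++ P Q h | ∑-++ P (Q ++ R) h | ∑-++ Q R h =
    +-assoc (∑ P h) (∑ Q h) (∑ R h)

  ++-identityʳ : ∀ P → P ++ [] ≈[ N ] P
  ++-identityʳ P .run h v rewrite ∑-++ P [] h = +-identityʳ _

  ⊗-distribʳ-++ : ∀ P Q R → (P ++ Q) ⊗ R ≈[ N ] P ⊗ R ++ Q ⊗ R
  ⊗-distribʳ-++ P Q R .run h v rewrite ∑-⊗ (P ++ Q) R h | ∑-++ (P ⊗ R) (Q ⊗ R) h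
    | ∑-⊗ P R h | ∑-⊗ Q R h = ∑-++ P Q _

  ⊗-distribˡ-++ : ∀ P Q R → P ⊗ (Q ++ R) ≈[ N ] P ⊗ Q ++ P ⊗ R
  ⊗-distribˡ-++ P Q R .run h v rewrite ∑-⊗ P (Q ++ R) h | ∑-++ (P ⊗ Q) (P ⊗ R) h
    | ∑-⊗ P Q h | ∑-⊗ P R h = trans (∑-cong P (λ x → ∑-++ Q R _)) (∑-+ P _ _)

  ⊗-identityʳ : ∀ P → P ⊗ one ≈[ N ] P
  ⊗-identityʳ P .run h v rewrite ∑-⊗ P one h =
    ∑-cong P (λ x → trans (+-identityʳ _) (cong h (+-identityʳ x)))

  ⊗-identityˡ : ∀ P → one ⊗ P ≈[ N ] P
  ⊗-identityˡ P .run h v rewrite ∑-⊗ one P h = +-identityʳ _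

  ⊗-zeroʳ : ∀ P → P ⊗ [] ≈[ N ] []
  ⊗-zeroʳ P .run h v rewrite ∑-⊗ P [] h = ∑-zero P (λ _ → refl)

  ⊗-zeroˡ : ∀ P → [] ⊗ P ≈[ N ] []
  ⊗-zeroˡ P .run h v = ∑-⊗ [] P h

  ⊗-leftComm : ∀ P Q R → P ⊗ (Q ⊗ R) ≈[ N ] Q ⊗ (P ⊗ R)
  ⊗-leftComm P Q R =
    P ⊗ (Q ⊗ R)  ≈⟨ ≈-sym (⊗-assoc P Q R) ⟩
    (P ⊗ Q) ⊗ R  ≈⟨ ⊗-congˡ R (⊗-comm P Q) ⟩
    (Q ⊗ P) ⊗ R  ≈⟨ ⊗-assoc Q P R ⟩
    Q ⊗ (P ⊗ R)  ∎≈

  ⊗-interchange : ∀ P Q R S → (P ⊗ Q) ⊗ (R ⊗ S) ≈[ N ] (P ⊗ R) ⊗ (Q ⊗ S)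
  ⊗-interchange P Q R S =
    (P ⊗ Q) ⊗ (R ⊗ S)  ≈⟨ ⊗-assoc P Q (R ⊗ S) ⟩
    P ⊗ (Q ⊗ (R ⊗ S))  ≈⟨ ⊗-congʳ P (⊗-leftComm Q R S) ⟩
    P ⊗ (R ⊗ (Q ⊗ S))  ≈⟨ ≈-sym (⊗-assoc P R (Q ⊗ S)) ⟩
    (P ⊗ R) ⊗ (Q ⊗ S)  ∎≈

  scalar-suc : ∀ b X → scalar (suc b) ⊗ X ≈[ N ] X ++ scalar b ⊗ X
  scalar-suc b X .run h v rewrite ∑-scalar⊗ (suc b) X h | ∑-++ X (scalar b ⊗ X) h | ∑-scalar⊗ b X h = refl

  q^-+ : ∀ c d → q^ (c + d) ≈[ N ] q^ c ⊗ q^ d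
  q^-+ c d .run h v = sym (∑-q^⊗ c (q^ d) h)

  q^-vanish : ∀ c → N < c → q^ c ≈[ N ] []
  q^-vanish c N<c .run h v rewrite v c N<c = refl

∏ : ℕ → (ℕ → Poly) → Poly
∏ zero    P = one
∏ (suc m) P = P 0 ⊗ ∏ m (P ∘ suc)

∑ₚ : ℕ → (ℕ → Poly) → Poly
∑ₚ zero    C = []
∑ₚ (suc m) C = C 0 ++ ∑ₚ m (C ∘ suc)

-- Σᵢ Mᵢ ∏_{j ≠ i} Pⱼ, the derivative of ∏ᵢ Pᵢ when each Mᵢ is the derivative of Pᵢ.
∂∏ : ℕ → (ℕ → Poly) → (ℕ → Poly) → Poly
∂∏ zero    P M = []
∂∏ (suc m) P M = M 0 ⊗ ∏ m (P ∘ suc) ++ P 0 ⊗ ∂∏ m (P ∘ suc) (M ∘ suc)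

pow : Poly → ℕ → Poly
pow P b = ∏ b (λ _ → P)

IsGenPoly : {A : Set} → List A → (A → ℕ) → Poly → Set
IsGenPoly xs w P = ∀ h → ∑ P h ≡ ∑ xs (h ∘ w)

IsMarkedGenPoly : {A : Set} → List A → (A → ℕ) → (A → ℕ) → Poly → Set
IsMarkedGenPoly xs v w M = ∀ h → ∑ M h ≡ ∑ xs (λ x → v x * h (w x))

module _ {A : Set} (xs : List A) where
  ∏-isGenPoly : ∀ m (ws : Fin m → A → ℕ) (P : ℕ → Poly) →
    (∀ i → IsGenPoly xs (ws i) (P (toℕ i))) →
    IsGenPoly (allFuns m xs) (λ f → ΣFin m (λ i → ws i (f i))) (∏ m P)
  ∏-isGenPoly zero    ws P hP h = refl
  ∏-isGenPoly (suc m) ws P hP h = begin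
    ∑ (∏ (suc m) P) h
      ≡⟨ ∑-⊗ (P 0) _ h ⟩
    ∑ (P 0) (λ y → ∑ (∏ m (P ∘ suc)) (λ s → h (y + s)))
      ≡⟨ hP Fin.zero _ ⟩
    ∑ xs (λ x → ∑ (∏ m (P ∘ suc)) (λ s → h (ws Fin.zero x + s)))
      ≡⟨ ∑-cong xs (λ x → ∏-isGenPoly m (ws ∘ Fin.suc) (P ∘ suc) (hP ∘ Fin.suc) _) ⟩
    ∑ xs (λ x → ∑ (allFuns m xs) (λ g → h (ws Fin.zero x + ΣFin m (λ i → ws (Fin.suc i) (g i)))))
      ≡⟨ ∑-allFuns-suc m xs _ ⟨
    ∑ (allFuns (suc m) xs) (λ f → h (ws Fin.zero (f Fin.zero) + ΣFin m (λ i → ws (Fin.suc i) (f (Fin.suc i)))))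
      ≡⟨ ∑-cong (allFuns (suc m) xs) (λ f → cong h (ΣFin-suc m _)) ⟨
    ∑ (allFuns (suc m) xs) (λ f → h (ΣFin (suc m) (λ i → ws i (f i)))) ∎
    where open ≡-Reasoning

  ∂∏-isMarkedGenPoly : ∀ m (ws vs : Fin m → A → ℕ) (P M : ℕ → Poly) →
    (∀ i → IsGenPoly xs (ws i) (P (toℕ i))) →
    (∀ i → IsMarkedGenPoly xs (vs i) (ws i) (M (toℕ i))) →
    IsMarkedGenPoly (allFuns m xs) (λ f → ΣFin m (λ i → vs i (f i))) (λ f → ΣFin m (λ i → ws i (f i)))
      (∂∏ m P M)
  ∂∏-isMarkedGenPoly zero    ws vs P M hP hM h = refl
  ∂∏-isMarkedGenPoly (suc m) ws vs P M hP hM h = begin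
    ∑ (∂∏ (suc m) P M) h
      ≡⟨ ∑-++ (M 0 ⊗ _) _ h ⟩
    ∑ (M 0 ⊗ ∏ m (P ∘ suc)) h + ∑ (P 0 ⊗ ∂∏ m (P ∘ suc) (M ∘ suc)) h
      ≡⟨ cong₂ _+_ (∑-⊗ (M 0) _ h) (∑-⊗ (P 0) _ h) ⟩
    ∑ (M 0) (λ y → ∑ (∏ m (P ∘ suc)) (λ s → h (y + s)))
      + ∑ (P 0) (λ y → ∑ (∂∏ m (P ∘ suc) (M ∘ suc)) (λ s → h (y + s)))
      ≡⟨ cong₂ _+_ (hM Fin.zero _) (hP Fin.zero _) ⟩
    ∑ xs (λ x → v₀ x * ∑ (∏ m (P ∘ suc)) (λ s → h (w₀ x + s)))
      + ∑ xs (λ x → ∑ (∂∏ m (P ∘ suc) (M ∘ suc)) (λ s → h (w₀ x + s)))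
      ≡⟨ cong₂ _+_
           (∑-cong xs (λ x → cong (v₀ x *_)
             (∏-isGenPoly m (ws ∘ Fin.suc) (P ∘ suc) (hP ∘ Fin.suc) _)))
           (∑-cong xs (λ x →
             ∂∏-isMarkedGenPoly m (ws ∘ Fin.suc) (vs ∘ Fin.suc) (P ∘ suc) (M ∘ suc)
               (hP ∘ Fin.suc) (hM ∘ Fin.suc) _)) ⟩
    ∑ xs (λ x → v₀ x * ∑ (allFuns m xs) (λ g → h (w₀ x + W g)))
      + ∑ xs (λ x → ∑ (allFuns m xs) (λ g → V g * h (w₀ x + W g)))
      ≡⟨ ∑-+ xs _ _ ⟨
    ∑ xs (λ x → v₀ x * ∑ (allFuns m xs) (λ g → h (w₀ x + W g))
               + ∑ (allFuns m xs) (λ g → V g * h (w₀ x + W g)))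
      ≡⟨ ∑-cong xs (λ x → ∑-*ˡ-+ (allFuns m xs) (v₀ x) V (λ g → h (w₀ x + W g))) ⟩
    ∑ xs (λ x → ∑ (allFuns m xs) (λ g → (v₀ x + V g) * h (w₀ x + W g)))
      ≡⟨ ∑-allFuns-suc m xs _ ⟨
    ∑ (allFuns (suc m) xs) (λ f → (v₀ (f Fin.zero) + V (f ∘ Fin.suc)) * h (w₀ (f Fin.zero) + W (f ∘ Fin.suc)))
      ≡⟨ ∑-cong (allFuns (suc m) xs) (λ f →
           cong₂ (λ a b → a * h b) (ΣFin-suc m (λ i → vs i (f i))) (ΣFin-suc m (λ i → ws i (f i)))) ⟨
    ∑ (allFuns (suc m) xs) (λ f → ΣFin (suc m) (λ i → vs i (f i)) * h (ΣFin (suc m) (λ i → ws i (f i)))) ∎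
    where
    open ≡-Reasoning
    v₀ w₀ : A → ℕ
    v₀ = vs Fin.zero
    w₀ = ws Fin.zero
    V W : (Fin m → A) → ℕ
    V g = ΣFin m (λ i → vs (Fin.suc i) (g i))
    W g = ΣFin m (λ i → ws (Fin.suc i) (g i))

module _ {N : ℕ} where
  ∏-cong : ∀ m {P Q} → (∀ i → P i ≈[ N ] Q i) → ∏ m P ≈[ N ] ∏ m Q
  ∏-cong zero    e = ≈-refl
  ∏-cong (suc m) e = ⊗-cong (e 0) (∏-cong m (e ∘ suc))

  ∑ₚ-cong : ∀ m {P Q} → (∀ i → P i ≈[ N ] Q i) → ∑ₚ m P ≈[ N ] ∑ₚ m Q
  ∑ₚ-cong zero    e = ≈-refl
  ∑ₚ-cong (suc m) e = ++-cong (e 0) (∑ₚ-cong m (e ∘ suc))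

  ∏-distrib-⊗ : ∀ m P Q → ∏ m (λ i → P i ⊗ Q i) ≈[ N ] ∏ m P ⊗ ∏ m Q
  ∏-distrib-⊗ zero    P Q = ≈-sym (⊗-identityˡ one)
  ∏-distrib-⊗ (suc m) P Q =
    (P 0 ⊗ Q 0) ⊗ ∏ m (λ i → P (suc i) ⊗ Q (suc i))
      ≈⟨ ⊗-congʳ (P 0 ⊗ Q 0) (∏-distrib-⊗ m (P ∘ suc) (Q ∘ suc)) ⟩
    (P 0 ⊗ Q 0) ⊗ (∏ m (P ∘ suc) ⊗ ∏ m (Q ∘ suc))
      ≈⟨ ⊗-interchange (P 0) (Q 0) _ _ ⟩
    ∏ (suc m) P ⊗ ∏ (suc m) Q ∎≈

  ∏-one : ∀ m P → (∀ i → P i ≈[ N ] one) → ∏ m P ≈[ N ] one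
  ∏-one zero    P e = ≈-refl
  ∏-one (suc m) P e =
    P 0 ⊗ ∏ m (P ∘ suc) ≈⟨ ⊗-cong (e 0) (∏-one m (P ∘ suc) (e ∘ suc)) ⟩
    one ⊗ one           ≈⟨ ⊗-identityˡ one ⟩
    one                 ∎≈

  ∏-comm : ∀ m b (Z : ℕ → ℕ → Poly) → ∏ m (λ i → ∏ b (Z i)) ≈[ N ] ∏ b (λ c → ∏ m (λ i → Z i c))
  ∏-comm zero    b Z = ≈-sym (∏-one b (λ _ → one) (λ _ → ≈-refl))
  ∏-comm (suc m) b Z =
    ∏ b (Z 0) ⊗ ∏ m (λ i → ∏ b (Z (suc i)))
      ≈⟨ ⊗-congʳ _ (∏-comm m b (Z ∘ suc)) ⟩
    ∏ b (Z 0) ⊗ ∏ b (λ c → ∏ m (λ i → Z (suc i) c))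
      ≈⟨ ≈-sym (∏-distrib-⊗ b (Z 0) (λ c → ∏ m (λ i → Z (suc i) c))) ⟩
    ∏ b (λ c → ∏ (suc m) (λ i → Z i c)) ∎≈

  ∏-truncate : ∀ L M P → M ≤ L → (∀ i → M ≤ i → P i ≈[ N ] one) → ∏ L P ≈[ N ] ∏ M P
  ∏-truncate L       zero    P M≤L e = ∏-one L P (λ i → e i z≤n)
  ∏-truncate (suc L) (suc M) P (s≤s M≤L) e =
    ⊗-congʳ (P 0) (∏-truncate L M (P ∘ suc) M≤L (λ i M≤i → e (suc i) (s≤s M≤i)))

  ∑ₚ-truncate : ∀ L M C → M ≤ L → (∀ i → M ≤ i → C i ≈[ N ] []) → ∑ₚ L C ≈[ N ] ∑ₚ M C
  ∑ₚ-truncate L       zero    C M≤L e = vanish L C (λ i → e i z≤n)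
    where
    vanish : ∀ L C → (∀ i → C i ≈[ N ] []) → ∑ₚ L C ≈[ N ] []
    vanish zero    C e = ≈-refl
    vanish (suc L) C e = ++-cong (e 0) (vanish L (C ∘ suc) (e ∘ suc))
  ∑ₚ-truncate (suc L) (suc M) C (s≤s M≤L) e =
    ++-cong ≈-refl (∑ₚ-truncate L M (C ∘ suc) M≤L (λ i M≤i → e (suc i) (s≤s M≤i)))

  ∑ₚ-⊗ˡ : ∀ m X C → ∑ₚ m (λ i → X ⊗ C i) ≈[ N ] X ⊗ ∑ₚ m C
  ∑ₚ-⊗ˡ zero    X C = ≈-sym (⊗-zeroʳ X)
  ∑ₚ-⊗ˡ (suc m) X C =
    X ⊗ C 0 ++ ∑ₚ m (λ i → X ⊗ C (suc i)) ≈⟨ ++-cong ≈-refl (∑ₚ-⊗ˡ m X (C ∘ suc)) ⟩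
    X ⊗ C 0 ++ X ⊗ ∑ₚ m (C ∘ suc)         ≈⟨ ≈-sym (⊗-distribˡ-++ X (C 0) (∑ₚ m (C ∘ suc))) ⟩
    X ⊗ ∑ₚ (suc m) C                       ∎≈

  ∂∏-const : ∀ b P M → ∂∏ (suc b) (λ _ → P) (λ _ → M) ≈[ N ] scalar (suc b) ⊗ (M ⊗ pow P b)
  ∂∏-const zero P M = ≈-sym (
    scalar 1 ⊗ (M ⊗ one)             ≈⟨ scalar-suc 0 (M ⊗ one) ⟩
    M ⊗ one ++ scalar 0 ⊗ (M ⊗ one)  ≈⟨ ++-cong ≈-refl (≈-trans (⊗-zeroˡ _) (≈-sym (⊗-zeroʳ P))) ⟩
    M ⊗ one ++ P ⊗ []                ∎≈)
  ∂∏-const (suc b) P M =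
    M ⊗ pow P (suc b) ++ P ⊗ ∂∏ (suc b) (λ _ → P) (λ _ → M)
      ≈⟨ ++-cong ≈-refl (⊗-congʳ P (∂∏-const b P M)) ⟩
    M ⊗ pow P (suc b) ++ P ⊗ (scalar (suc b) ⊗ (M ⊗ pow P b))
      ≈⟨ ++-cong ≈-refl (⊗-leftComm P (scalar (suc b)) _) ⟩
    M ⊗ pow P (suc b) ++ scalar (suc b) ⊗ (P ⊗ (M ⊗ pow P b))
      ≈⟨ ++-cong ≈-refl (⊗-congʳ (scalar (suc b)) (⊗-leftComm P M (pow P b))) ⟩
    M ⊗ pow P (suc b) ++ scalar (suc b) ⊗ (M ⊗ pow P (suc b))
      ≈⟨ ≈-sym (scalar-suc (suc b) _) ⟩
    scalar (suc (suc b)) ⊗ (M ⊗ pow P (suc b)) ∎≈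

  ∂∏-zero : ∀ m P M → (∀ i → i < m → M i ≈[ N ] []) → ∂∏ m P M ≈[ N ] []
  ∂∏-zero zero    P M e = ≈-refl
  ∂∏-zero (suc m) P M e =
    M 0 ⊗ ∏ m (P ∘ suc) ++ P 0 ⊗ ∂∏ m (P ∘ suc) (M ∘ suc)
      ≈⟨ ++-cong (≈-trans (⊗-congˡ _ (e 0 (s≤s z≤n))) (⊗-zeroˡ _))
                 (⊗-congʳ (P 0) (∂∏-zero m (P ∘ suc) (M ∘ suc) (λ i i<m → e (suc i) (s≤s i<m)))) ⟩
    [] ++ P 0 ⊗ []
      ≈⟨ ⊗-zeroʳ (P 0) ⟩
    [] ∎≈

  ∂∏-concentrated : ∀ m P M i₀ → i₀ < m → (∀ i → i ≢ i₀ → M i ≈[ N ] []) →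
    Σ Poly λ R → (∏ m P ≈[ N ] P i₀ ⊗ R) × (∂∏ m P M ≈[ N ] M i₀ ⊗ R)
  ∂∏-concentrated (suc m) P M zero i₀<m e = ∏ m (P ∘ suc) , ≈-refl ,
    (M 0 ⊗ ∏ m (P ∘ suc) ++ P 0 ⊗ ∂∏ m (P ∘ suc) (M ∘ suc)
      ≈⟨ ++-cong ≈-refl (⊗-congʳ (P 0) (∂∏-zero m _ _ (λ i _ → e (suc i) (λ ())))) ⟩
    M 0 ⊗ ∏ m (P ∘ suc) ++ P 0 ⊗ []
      ≈⟨ ++-cong ≈-refl (⊗-zeroʳ (P 0)) ⟩
    M 0 ⊗ ∏ m (P ∘ suc) ++ []
      ≈⟨ ++-identityʳ _ ⟩
    M 0 ⊗ ∏ m (P ∘ suc) ∎≈)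
  ∂∏-concentrated (suc m) P M (suc j) (s≤s j<m) e
    with R , ∏≈ , ∂∏≈ ← ∂∏-concentrated m (P ∘ suc) (M ∘ suc) j j<m (λ i i≢j → e (suc i) (i≢j ∘ suc-injective))
    = P 0 ⊗ R ,
    (P 0 ⊗ ∏ m (P ∘ suc)   ≈⟨ ⊗-congʳ (P 0) ∏≈ ⟩
     P 0 ⊗ (P (suc j) ⊗ R)  ≈⟨ ⊗-leftComm (P 0) (P (suc j)) R ⟩
     P (suc j) ⊗ (P 0 ⊗ R)  ∎≈) ,
    (M 0 ⊗ ∏ m (P ∘ suc) ++ P 0 ⊗ ∂∏ m (P ∘ suc) (M ∘ suc)
      ≈⟨ ++-cong (≈-trans (⊗-congˡ _ (e 0 (λ ()))) (⊗-zeroˡ _)) (⊗-congʳ (P 0) ∂∏≈) ⟩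
     [] ++ P 0 ⊗ (M (suc j) ⊗ R)
      ≈⟨ ⊗-leftComm (P 0) (M (suc j)) R ⟩
     M (suc j) ⊗ (P 0 ⊗ R) ∎≈)

  -- Logarithmic differentiation.
  ∂∏-linear : ∀ m P M C → (∀ i → M i ≈[ N ] C i ⊗ P i) → ∂∏ m P M ≈[ N ] ∑ₚ m C ⊗ ∏ m P
  ∂∏-linear zero    P M C e = ≈-sym (⊗-zeroˡ one)
  ∂∏-linear (suc m) P M C e =
    M 0 ⊗ ∏ m (P ∘ suc) ++ P 0 ⊗ ∂∏ m (P ∘ suc) (M ∘ suc)
      ≈⟨ ++-cong (⊗-congˡ _ (e 0)) (⊗-congʳ (P 0) (∂∏-linear m (P ∘ suc) (M ∘ suc) (C ∘ suc) (e ∘ suc))) ⟩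
    (C 0 ⊗ P 0) ⊗ ∏ m (P ∘ suc) ++ P 0 ⊗ (∑ₚ m (C ∘ suc) ⊗ ∏ m (P ∘ suc))
      ≈⟨ ++-cong (⊗-assoc (C 0) (P 0) _) (⊗-leftComm (P 0) (∑ₚ m (C ∘ suc)) _) ⟩
    C 0 ⊗ ∏ (suc m) P ++ ∑ₚ m (C ∘ suc) ⊗ ∏ (suc m) P
      ≈⟨ ≈-sym (⊗-distribʳ-++ (C 0) (∑ₚ m (C ∘ suc)) (∏ (suc m) P)) ⟩
    ∑ₚ (suc m) C ⊗ ∏ (suc m) P ∎≈

-- Geometric series and the substitution q ↦ q²

double : ℕ → ℕ
double zero    = zero
double (suc n) = suc (suc (double n))

double≡+ : ∀ n → double n ≡ n + n
double≡+ zero    = refl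
double≡+ (suc n) rewrite double≡+ n = cong suc (sym (+-suc n n))

double-mono-≤ : ∀ {a b} → a ≤ b → double a ≤ double b
double-mono-≤ z≤n       = z≤n
double-mono-≤ (s≤s a≤b) = s≤s (s≤s (double-mono-≤ a≤b))

double-* : ∀ a t → double (a * t) ≡ double a * t
double-* a t rewrite double≡+ (a * t) | double≡+ a = sym (*-distribʳ-+ t a a)

⌊n/2⌋<m⇒n<double-m : ∀ n m → ⌊ n /2⌋ < m → n < double m
⌊n/2⌋<m⇒n<double-m zero          (suc m) _         = s≤s z≤n
⌊n/2⌋<m⇒n<double-m (suc zero)    (suc m) _         = s≤s (s≤s z≤n)
⌊n/2⌋<m⇒n<double-m (suc (suc n)) (suc m) (s≤s lt) = s≤s (s≤s (⌊n/2⌋<m⇒n<double-m n m lt))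

n≤double-⌈n/2⌉ : ∀ n → n ≤ double ⌈ n /2⌉
n≤double-⌈n/2⌉ zero          = z≤n
n≤double-⌈n/2⌉ (suc zero)    = s≤s z≤n
n≤double-⌈n/2⌉ (suc (suc n)) = s≤s (s≤s (n≤double-⌈n/2⌉ n))

m≤m*n′ : ∀ m n → 1 ≤ n → m ≤ m * n
m≤m*n′ m (suc n) _ = m≤m*n m (suc n)

∑< : ℕ → (ℕ → ℕ) → ℕ
∑< zero    f = 0
∑< (suc L) f = f 0 + ∑< L (f ∘ suc)

∑-applyUpTo : ∀ L (g : ℕ → ℕ) f → ∑ (applyUpTo g L) f ≡ ∑< L (f ∘ g)
∑-applyUpTo zero    g f = refl
∑-applyUpTo (suc L) g f = cong (_+_ (f (g 0))) (∑-applyUpTo L (g ∘ suc) f)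

∑<-cong : ∀ L {f g} → (∀ t → f t ≡ g t) → ∑< L f ≡ ∑< L g
∑<-cong zero    e = refl
∑<-cong (suc L) e = cong₂ _+_ (e 0) (∑<-cong L (e ∘ suc))

∑<-truncate : ∀ L L' f → L ≤ L' → (∀ t → L ≤ t → f t ≡ 0) → ∑< L' f ≡ ∑< L f
∑<-truncate zero    L'      f L≤L' e = vanish L' f (λ t → e t z≤n)
  where
  vanish : ∀ L f → (∀ t → f t ≡ 0) → ∑< L f ≡ 0
  vanish zero    f e = refl
  vanish (suc L) f e rewrite e 0 = vanish L (f ∘ suc) (e ∘ suc)
∑<-truncate (suc L) (suc L') f (s≤s L≤L') e =
  cong (_+_ (f 0)) (∑<-truncate L L' (f ∘ suc) L≤L' (λ t L≤t → e (suc t) (s≤s L≤t)))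

∑<-double : ∀ L f → ∑< (double L) f ≡ ∑< L (f ∘ double) + ∑< L (f ∘ suc ∘ double)
∑<-double zero    f = refl
∑<-double (suc L) f rewrite ∑<-double L (f ∘ suc ∘ suc) = regroup (f 0) (f 1) _ _
  where
  regroup : ∀ a b c d → a + (b + (c + d)) ≡ (a + c) + (b + d)
  regroup = solve-∀

∑<-from : ∀ k L (f : ℕ → ℕ) → ∑< L (λ t → ind ⌊ k ≤? t ⌋ * f t) ≡ ∑< (L ∸ k) (λ t → f (k + t))
∑<-from zero    L       f = ∑<-cong L (λ t → +-identityʳ (f t))
∑<-from (suc k) zero    f = refl
∑<-from (suc k) (suc L) f =
  trans (∑<-cong L (λ t → cong (λ b → ind b * f (suc t)) (suc≤?suc k t))) (∑<-from k L (f ∘ suc))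
  where
  suc≤?suc : ∀ k t → ⌊ suc k ≤? suc t ⌋ ≡ ⌊ k ≤? t ⌋
  suc≤?suc k t with k ≤? t | suc k ≤? suc t
  ... | yes _   | yes _   = refl
  ... | no _    | no _    = refl
  ... | yes k≤t | no k≰t  = ⊥-elim (k≰t (s≤s k≤t))
  ... | no k≰t  | yes k≤t = ⊥-elim (k≰t (s≤s⁻¹ k≤t))

geom : ℕ → ℕ → Poly
geom r L = applyUpTo (r *_) L

∑-geom : ∀ r L h → ∑ (geom r L) h ≡ ∑< L (λ t → h (r * t))
∑-geom r L h = ∑-applyUpTo L (r *_) h

module _ {N : ℕ} where
  geom-truncate : ∀ r L L' → L ≤ L' → (∀ t → L ≤ t → N < r * t) → geom r L' ≈[ N ] geom r L
  geom-truncate r L L' L≤L' big .run h v rewrite ∑-geom r L' h | ∑-geom r L h =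
    ∑<-truncate L L' _ L≤L' (λ t L≤t → v _ (big t L≤t))

  geom-≈one : ∀ r L → 1 ≤ L → N < r → geom r L ≈[ N ] one
  geom-≈one r L 1≤L N<r = ≈-trans
    (geom-truncate r 1 L 1≤L (λ t 1≤t → ≤-trans N<r (m≤m*n′ r t 1≤t)))
    (mk≈ λ h v → cong (λ e → h e + 0) (*-zeroʳ r))

  1+q^-≈one : ∀ r → N < r → 1+q^ r ≈[ N ] one
  1+q^-≈one r N<r .run h v rewrite v r N<r = refl

  geom-double : ∀ r L → geom r (double L) ≈[ N ] 1+q^ r ⊗ geom (double r) L
  geom-double r L .run h v = begin
    ∑ (geom r (double L)) h
      ≡⟨ ∑-geom r (double L) h ⟩
    ∑< (double L) (λ t → h (r * t))
      ≡⟨ ∑<-double L _ ⟩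
    ∑< L (λ s → h (r * double s)) + ∑< L (λ s → h (r * suc (double s)))
      ≡⟨ cong₂ _+_ (∑<-cong L (λ s → cong h (even s))) (∑<-cong L (λ s → cong h (odd s))) ⟩
    ∑< L (λ s → h (double r * s)) + ∑< L (λ s → h (r + double r * s))
      ≡⟨ cong₂ _+_ (∑-geom (double r) L h) (trans (+-identityʳ _) (∑-geom (double r) L _)) ⟨
    ∑ (1+q^ r) (λ x → ∑ (geom (double r) L) (λ y → h (x + y)))
      ≡⟨ ∑-⊗ (1+q^ r) (geom (double r) L) h ⟨
    ∑ (1+q^ r ⊗ geom (double r) L) h ∎
    where
    open ≡-Reasoning
    even : ∀ s → r * double s ≡ double r * s
    even s rewrite double≡+ s | double≡+ r = lemma r s
      where
      lemma : ∀ r s → r * (s + s) ≡ (r + r) * s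
      lemma = solve-∀
    odd : ∀ s → r * suc (double s) ≡ r + double r * s
    odd s rewrite double≡+ s | double≡+ r = lemma r s
      where
      lemma : ∀ r s → r * suc (s + s) ≡ r + (r + r) * s
      lemma = solve-∀

dilate : Poly → Poly
dilate P = map double P

∑-dilate : ∀ P h → ∑ (dilate P) h ≡ ∑ P (h ∘ double)
∑-dilate P h = ∑-map double P h

double-+ : ∀ x y → double (x + y) ≡ double x + double y
double-+ x y rewrite double≡+ (x + y) | double≡+ x | double≡+ y = lemma x y
  where
  lemma : ∀ x y → (x + y) + (x + y) ≡ (x + x) + (y + y)
  lemma = solve-∀

module _ {N : ℕ} where
  dilate-⊗ : ∀ P Q → dilate (P ⊗ Q) ≈[ N ] dilate P ⊗ dilate Q
  dilate-⊗ P Q .run h v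
    rewrite ∑-dilate (P ⊗ Q) h | ∑-⊗ P Q (h ∘ double) | ∑-⊗ (dilate P) (dilate Q) h
          | ∑-dilate P (λ x → ∑ (dilate Q) (λ y → h (x + y))) =
    ∑-cong P (λ x → trans (∑-cong Q (λ y → cong h (double-+ x y))) (sym (∑-dilate Q _)))

  dilate-cong : ∀ {P Q} → P ≈[ ⌊ N /2⌋ ] Q → dilate P ≈[ N ] dilate Q
  dilate-cong {P} {Q} e .run h v rewrite ∑-dilate P h | ∑-dilate Q h =
    run e (h ∘ double) (λ m lt → v (double m) (⌊n/2⌋<m⇒n<double-m N m lt))

  dilate-∏ : ∀ m X → dilate (∏ m X) ≈[ N ] ∏ m (dilate ∘ X)
  dilate-∏ zero    X = ≈-refl
  dilate-∏ (suc m) X = ≈-trans (dilate-⊗ (X 0) _) (⊗-congʳ (dilate (X 0)) (dilate-∏ m (X ∘ suc)))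

  dilate-geom : ∀ r L → dilate (geom r L) ≈[ N ] geom (double r) L
  dilate-geom r L .run h v rewrite ∑-dilate (geom r L) h | ∑-geom r L (h ∘ double) | ∑-geom (double r) L h =
    ∑<-cong L (λ t → cong h (double-* r t))

  ∏-evenOdd : ∀ m X → ∏ m X ≈[ N ] ∏ ⌈ m /2⌉ (X ∘ double) ⊗ ∏ ⌊ m /2⌋ (X ∘ suc ∘ double)
  ∏-evenOdd zero          X = ≈-sym (⊗-identityˡ one)
  ∏-evenOdd (suc zero)    X = ≈-sym (⊗-identityʳ _)
  ∏-evenOdd (suc (suc m)) X =
    X 0 ⊗ (X 1 ⊗ ∏ m (X ∘ suc ∘ suc)) ≈⟨ ⊗-congʳ (X 0) (⊗-congʳ (X 1) (∏-evenOdd m (X ∘ suc ∘ suc))) ⟩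
    X 0 ⊗ (X 1 ⊗ (Evens ⊗ Odds))       ≈⟨ ⊗-congʳ (X 0) (⊗-leftComm (X 1) Evens Odds) ⟩
    X 0 ⊗ (Evens ⊗ (X 1 ⊗ Odds))       ≈⟨ ≈-sym (⊗-assoc (X 0) Evens _) ⟩
    (X 0 ⊗ Evens) ⊗ (X 1 ⊗ Odds)       ∎≈
    where
    Evens = ∏ ⌈ m /2⌉ (X ∘ suc ∘ suc ∘ double)
    Odds  = ∏ ⌊ m /2⌋ (X ∘ suc ∘ suc ∘ suc ∘ double)

-- Euler's identity

distinctGF₁ : ℕ → Poly
distinctGF₁ N = ∏ N (λ i → 1+q^ suc i)

oddGF₁ : ℕ → ℕ → Poly
oddGF₁ U N = ∏ N (λ j → geom (suc (double j)) (suc U))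

-- Split ∏ (1 + qⁱ) by the parity of i: the even factors form the same product at q², to which induction
-- applies, and for odd r we have (1 + q^r)/(1 - q^{2r}) = 1/(1 - q^r).
euler₁ : ∀ N → distinctGF₁ N ≈[ N ] oddGF₁ N N
euler₁ n = euler-fuel n n ≤-refl
  where
  euler-fuel : ∀ fuel N → N ≤ fuel → distinctGF₁ N ≈[ N ] oddGF₁ N N
  euler-fuel fuel       zero     _ = ≈-refl
  euler-fuel (suc fuel) (suc N′) (s≤s N′≤fuel) =
    distinctGF₁ N
      ≈⟨ ∏-evenOdd N (λ i → 1+q^ suc i) ⟩
    ∏ M′ (λ j → 1+q^ r j) ⊗ ∏ M (λ i → dilate (1+q^ suc i))
      ≈⟨ ⊗-congʳ _ (≈-sym (dilate-∏ M (λ i → 1+q^ suc i))) ⟩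
    ∏ M′ (λ j → 1+q^ r j) ⊗ dilate (distinctGF₁ M)
      ≈⟨ ⊗-congʳ _ (dilate-cong (euler-fuel fuel M (≤-trans (s≤s⁻¹ (⌊n/2⌋<n N′)) N′≤fuel))) ⟩
    ∏ M′ (λ j → 1+q^ r j) ⊗ dilate (oddGF₁ M M)
      ≈⟨ ⊗-congʳ _ (≈-trans (dilate-∏ M _) (∏-cong M (λ j → dilate-geom (r j) (suc M)))) ⟩
    ∏ M′ (λ j → 1+q^ r j) ⊗ ∏ M (λ j → geom (double (r j)) (suc M))
      ≈⟨ ≈-sym (⊗-cong (∏-truncate N M′ _ (⌈n/2⌉≤n N) pairs-trivial)
                        (∏-truncate N M _ (⌊n/2⌋≤n N) geoms-trivial)) ⟩
    ∏ N (λ j → 1+q^ r j) ⊗ ∏ N (λ j → geom (double (r j)) (suc M))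
      ≈⟨ ⊗-congʳ _ (∏-cong N (λ j → ≈-sym (geom-truncate (double (r j)) (suc M) (suc N)
                                             (s≤s (⌊n/2⌋≤n N)) (long-geom-terms j)))) ⟩
    ∏ N (λ j → 1+q^ r j) ⊗ ∏ N (λ j → geom (double (r j)) (suc N))
      ≈⟨ ≈-sym (∏-distrib-⊗ N (λ j → 1+q^ r j) (λ j → geom (double (r j)) (suc N))) ⟩
    ∏ N (λ j → 1+q^ r j ⊗ geom (double (r j)) (suc N))
      ≈⟨ ≈-sym (∏-cong N (λ j → geom-double (r j) (suc N))) ⟩
    ∏ N (λ j → geom (r j) (double (suc N)))
      ≈⟨ ∏-cong N (λ j → geom-truncate (r j) (suc N) (double (suc N)) N<double-N (odd-geom-terms j)) ⟩
    oddGF₁ N N ∎≈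
    where
    N = suc N′
    M = ⌊ N /2⌋
    M′ = ⌈ N /2⌉
    r : ℕ → ℕ
    r j = suc (double j)
    N<double-1+M : N < double (suc M)
    N<double-1+M = ⌊n/2⌋<m⇒n<double-m N (suc M) ≤-refl
    1+j≤r : ∀ j → suc j ≤ r j
    1+j≤r zero    = s≤s z≤n
    1+j≤r (suc j) = s≤s (≤-trans (1+j≤r j) (n≤1+n _))
    pairs-trivial : ∀ j → M′ ≤ j → 1+q^ r j ≈[ N ] one
    pairs-trivial j M′≤j = 1+q^-≈one (r j) (s≤s (≤-trans (n≤double-⌈n/2⌉ N) (double-mono-≤ M′≤j)))
    geoms-trivial : ∀ j → M ≤ j → geom (double (r j)) (suc M) ≈[ N ] one
    geoms-trivial j M≤j = geom-≈one (double (r j)) (suc M) (s≤s z≤n)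
      (≤-trans N<double-1+M (double-mono-≤ (≤-trans (s≤s M≤j) (1+j≤r j))))
    long-geom-terms : ∀ j t → suc M ≤ t → N < double (r j) * t
    long-geom-terms j t 1+M≤t = ≤-trans N<double-1+M (≤-trans (double-mono-≤ 1+M≤t)
      (subst (double t ≤_) (double-* (r j) t) (double-mono-≤ (m≤n*m t (r j)))))
    N<double-N : suc N ≤ double (suc N)
    N<double-N = subst (suc N ≤_) (sym (double≡+ (suc N))) (m≤m+n (suc N) (suc N))
    odd-geom-terms : ∀ j t → suc N ≤ t → N < r j * t
    odd-geom-terms j t 1+N≤t = ≤-trans 1+N≤t (m≤n*m t (r j))

distinctFactor : ℕ → ℕ → Poly
distinctFactor b i = pow (1+q^ suc i) b

oddFactor : ℕ → ℕ → ℕ → Poly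
oddFactor b U j = pow (geom (suc (2 * j)) (suc U)) b

distinctGF : ℕ → ℕ → Poly
distinctGF b n = ∏ n (distinctFactor b)

oddGF : ℕ → ℕ → Poly
oddGF b U = ∏ U (oddFactor b U)

euler : ∀ b n → distinctGF b n ≈[ n ] oddGF b n
euler b n =
  distinctGF b n                        ≈⟨ ∏-comm n b (λ i c → 1+q^ suc i) ⟩
  pow (distinctGF₁ n) b                 ≈⟨ ∏-cong b (λ _ → euler₁ n) ⟩
  pow (oddGF₁ n n) b                    ≈⟨ ≈-sym (∏-comm n b (λ j c → geom (suc (double j)) (suc n))) ⟩
  ∏ n (λ j → pow (geom (suc (double j)) (suc n)) b)
    ≈⟨ ∏-cong n (λ j → ≡⇒≈ (cong (λ d → pow (geom (suc d) (suc n)) b) (double≡2* j))) ⟩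
  oddGF b n                             ∎≈
  where
  double≡2* : ∀ j → double j ≡ 2 * j
  double≡2* j = trans (double≡+ j) (cong (_+_ j) (sym (+-identityʳ j)))

-- Generating functions of the two statistics

distinctMarked : ℕ → ℕ → ℕ → Poly
distinctMarked b k i = ∂∏ b (λ _ → 1+q^ suc i) (λ _ → replicate (ind ⌊ suc i ≟ k ⌋) (suc i))

Fd≡coeff : ∀ b k n → Fd b k n ≡ coeff n (∂∏ n (distinctFactor b) (distinctMarked b k))
Fd≡coeff b k n =
  trans (∑-filter (allFuns n (allFuns b bits)) (dSize n b) (partsOfSize n b k) n)
        (sym (∂∏-isMarkedGenPoly (allFuns b bits) n sizes counts (distinctFactor b) (distinctMarked b k)
                hP hM (λ a → ind ⌊ a ≟ n ⌋)))
  where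
  bits : List Bool
  bits = false ∷ true ∷ []
  size count : ℕ → Bool → ℕ
  size s x = s * ind x
  count s x = ind x * ind ⌊ s ≟ k ⌋
  sizes counts : Fin n → (Fin b → Bool) → ℕ
  sizes i g = ΣFin b (λ c → size (suc (toℕ i)) (g c))
  counts i g = ΣFin b (λ c → count (suc (toℕ i)) (g c))
  pair-isGenPoly : ∀ s → IsGenPoly bits (size s) (1+q^ s)
  pair-isGenPoly s h rewrite *-zeroʳ s | *-identityʳ s = refl
  part-isMarkedGenPoly : ∀ s → IsMarkedGenPoly bits (count s) (size s) (replicate (ind ⌊ s ≟ k ⌋) s)
  part-isMarkedGenPoly s h rewrite ∑-replicate (ind ⌊ s ≟ k ⌋) s h | *-identityʳ s
    | +-identityʳ (ind ⌊ s ≟ k ⌋) = sym (+-identityʳ _)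
  hP : ∀ i → IsGenPoly (allFuns b bits) (sizes i) (distinctFactor b (toℕ i))
  hP i = ∏-isGenPoly bits b (λ _ → size (suc (toℕ i))) _ (λ _ → pair-isGenPoly (suc (toℕ i)))
  hM : ∀ i → IsMarkedGenPoly (allFuns b bits) (counts i) (sizes i) (distinctMarked b k (toℕ i))
  hM i = ∂∏-isMarkedGenPoly bits b (λ _ → size (suc (toℕ i))) (λ _ → count (suc (toℕ i))) _ _
           (λ _ → pair-isGenPoly (suc (toℕ i))) (λ _ → part-isMarkedGenPoly (suc (toℕ i)))

atLeast : ℕ → ℕ → ℕ → Poly
atLeast k U r = concatMap (λ t → replicate (ind ⌊ k ≤? t ⌋) (r * t)) (upTo (suc U))

oddMarked : ℕ → ℕ → ℕ → ℕ → Poly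
oddMarked b k U j = ∂∏ b (λ _ → geom (suc (2 * j)) (suc U)) (λ _ → atLeast k U (suc (2 * j)))

geom-isGenPoly : ∀ U r → IsGenPoly (upTo (suc U)) (r *_) (geom r (suc U))
geom-isGenPoly U r h = trans (∑-geom r (suc U) h) (sym (∑-applyUpTo (suc U) id (λ t → h (r * t))))

atLeast-isMarkedGenPoly : ∀ k U r →
  IsMarkedGenPoly (upTo (suc U)) (λ t → ind ⌊ k ≤? t ⌋) (r *_) (atLeast k U r)
atLeast-isMarkedGenPoly k U r h =
  trans (∑-concatMap (λ t → replicate (ind ⌊ k ≤? t ⌋) (r * t)) (upTo (suc U)) h)
        (∑-cong (upTo (suc U)) (λ t → ∑-replicate (ind ⌊ k ≤? t ⌋) (r * t) h))

Go≡coeff : ∀ b k U → Go b k U ≡ coeff U (∂∏ U (oddFactor b U) (oddMarked b k U))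
Go≡coeff b k U =
  trans (∑-filter (allFuns U (allFuns b (upTo (suc U)))) (oSize U b) (go U b k) U)
        (sym (∂∏-isMarkedGenPoly (allFuns b (upTo (suc U))) U sizes counts (oddFactor b U) (oddMarked b k U)
                hP hM (λ a → ind ⌊ a ≟ U ⌋)))
  where
  sizes counts : Fin U → (Fin b → ℕ) → ℕ
  sizes j g = ΣFin b (λ c → suc (2 * toℕ j) * g c)
  counts j g = ΣFin b (λ c → ind ⌊ k ≤? g c ⌋)
  hP : ∀ j → IsGenPoly (allFuns b (upTo (suc U))) (sizes j) (oddFactor b U (toℕ j))
  hP j = ∏-isGenPoly (upTo (suc U)) b (λ _ → suc (2 * toℕ j) *_) _ (λ _ → geom-isGenPoly U (suc (2 * toℕ j)))
  hM : ∀ j → IsMarkedGenPoly (allFuns b (upTo (suc U))) (counts j) (sizes j) (oddMarked b k U (toℕ j))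
  hM j = ∂∏-isMarkedGenPoly (upTo (suc U)) b (λ _ → suc (2 * toℕ j) *_) (λ _ t → ind ⌊ k ≤? t ⌋) _ _
           (λ _ → geom-isGenPoly U (suc (2 * toℕ j))) (λ _ → atLeast-isMarkedGenPoly k U (suc (2 * toℕ j)))

oddMultiples : ℕ → ℕ → Poly
oddMultiples k L = ∑ₚ L (λ j → q^ (k * suc (2 * j)))

module _ {U : ℕ} where
  atLeast-≈ : ∀ k r → 1 ≤ r → atLeast k U r ≈[ U ] q^ (k * r) ⊗ geom r (suc U)
  atLeast-≈ k r 1≤r .run h v = begin
    ∑ (atLeast k U r) h
      ≡⟨ atLeast-isMarkedGenPoly k U r h ⟩
    ∑ (upTo (suc U)) (λ t → ind ⌊ k ≤? t ⌋ * h (r * t))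
      ≡⟨ ∑-applyUpTo (suc U) id _ ⟩
    ∑< (suc U) (λ t → ind ⌊ k ≤? t ⌋ * h (r * t))
      ≡⟨ ∑<-from k (suc U) (λ t → h (r * t)) ⟩
    ∑< (suc U ∸ k) (λ t → h (r * (k + t)))
      ≡⟨ ∑<-cong (suc U ∸ k) (λ t → cong h (distrib t)) ⟩
    ∑< (suc U ∸ k) (λ t → h (k * r + r * t))
      ≡⟨ ∑<-truncate (suc U ∸ k) (suc U) _ (m∸n≤m (suc U) k) vanish ⟨
    ∑< (suc U) (λ t → h (k * r + r * t))
      ≡⟨ ∑-geom r (suc U) _ ⟨
    ∑ (geom r (suc U)) (λ y → h (k * r + y))
      ≡⟨ ∑-q^⊗ (k * r) (geom r (suc U)) h ⟨
    ∑ (q^ (k * r) ⊗ geom r (suc U)) h ∎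
    where
    open ≡-Reasoning
    distrib : ∀ t → r * (k + t) ≡ k * r + r * t
    distrib t = trans (*-distribˡ-+ r k t) (cong (_+ r * t) (*-comm r k))
    vanish : ∀ t → suc U ∸ k ≤ t → h (k * r + r * t) ≡ 0
    vanish t le = v _ (subst (U <_) (distrib t)
      (≤-trans (≤-trans (m≤n+m∸n (suc U) k) (+-monoʳ-≤ k le))
        (subst (k + t ≤_) (*-comm (k + t) r) (m≤m*n′ (k + t) r 1≤r))))

  oddMarked-≈ : ∀ b′ k j → oddMarked (suc b′) k U j
    ≈[ U ] (scalar (suc b′) ⊗ q^ (k * suc (2 * j))) ⊗ oddFactor (suc b′) U j
  oddMarked-≈ b′ k j =
    oddMarked (suc b′) k U j
      ≈⟨ ∂∏-const b′ Geom (atLeast k U r) ⟩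
    scalar (suc b′) ⊗ (atLeast k U r ⊗ pow Geom b′)
      ≈⟨ ⊗-congʳ (scalar (suc b′)) (⊗-congˡ (pow Geom b′) (atLeast-≈ k r (s≤s z≤n))) ⟩
    scalar (suc b′) ⊗ ((q^ (k * r) ⊗ Geom) ⊗ pow Geom b′)
      ≈⟨ ⊗-congʳ (scalar (suc b′)) (⊗-assoc (q^ (k * r)) Geom (pow Geom b′)) ⟩
    scalar (suc b′) ⊗ (q^ (k * r) ⊗ oddFactor (suc b′) U j)
      ≈⟨ ≈-sym (⊗-assoc (scalar (suc b′)) (q^ (k * r)) _) ⟩
    (scalar (suc b′) ⊗ q^ (k * r)) ⊗ oddFactor (suc b′) U j ∎≈
    where
    r = suc (2 * j)
    Geom = geom r (suc U)

  ∂∏-odd : ∀ b′ k → ∂∏ U (oddFactor (suc b′) U) (oddMarked (suc b′) k U)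
    ≈[ U ] scalar (suc b′) ⊗ (oddMultiples k U ⊗ oddGF (suc b′) U)
  ∂∏-odd b′ k =
    ∂∏ U (oddFactor (suc b′) U) (oddMarked (suc b′) k U)
      ≈⟨ ∂∏-linear U _ _ (λ j → scalar (suc b′) ⊗ q^ (k * suc (2 * j))) (oddMarked-≈ b′ k) ⟩
    ∑ₚ U (λ j → scalar (suc b′) ⊗ q^ (k * suc (2 * j))) ⊗ oddGF (suc b′) U
      ≈⟨ ⊗-congˡ (oddGF (suc b′) U) (∑ₚ-⊗ˡ U (scalar (suc b′)) (λ j → q^ (k * suc (2 * j)))) ⟩
    (scalar (suc b′) ⊗ oddMultiples k U) ⊗ oddGF (suc b′) U
      ≈⟨ ⊗-assoc (scalar (suc b′)) (oddMultiples k U) (oddGF (suc b′) U) ⟩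
    scalar (suc b′) ⊗ (oddMultiples k U ⊗ oddGF (suc b′) U) ∎≈

m≤j⇒m<1+2j : ∀ {m j} → m ≤ j → m < suc (2 * j)
m≤j⇒m<1+2j {m} {j} m≤j = s≤s (≤-trans m≤j (m≤m+n j (j + 0)))

oddGF-truncate : ∀ b {m n} → m ≤ n → oddGF b n ≈[ m ] oddGF b m
oddGF-truncate b {m} {n} m≤n =
  ∏ n (oddFactor b n)
    ≈⟨ ∏-truncate n m (oddFactor b n) m≤n
         (λ j m≤j → ∏-one b _ (λ _ → geom-≈one (suc (2 * j)) (suc n) (s≤s z≤n) (m≤j⇒m<1+2j m≤j))) ⟩
  ∏ m (oddFactor b n)
    ≈⟨ ∏-cong m (λ j → ∏-cong b (λ _ → geom-truncate (suc (2 * j)) (suc m) (suc n) (s≤s m≤n)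
         (λ t m<t → ≤-trans m<t (m≤n*m t (suc (2 * j)))))) ⟩
  ∏ m (oddFactor b m) ∎≈

oddMultiples-truncate : ∀ k {N} L M → M ≤ L → N < k * suc (2 * M) → oddMultiples k L ≈[ N ] oddMultiples k M
oddMultiples-truncate k L M M≤L N<k[2M+1] = ∑ₚ-truncate L M _ M≤L
  (λ j M≤j → q^-vanish _ (≤-trans N<k[2M+1] (*-monoʳ-≤ k (s≤s (*-monoʳ-≤ 2 M≤j)))))

Go≡b*coeff : ∀ b′ k n m → 1 ≤ k → m ≤ n →
  Go (suc b′) k m ≡ suc b′ * coeff m (oddMultiples k n ⊗ oddGF (suc b′) n)
Go≡b*coeff b′ k n m 1≤k m≤n = begin
  Go (suc b′) k m
    ≡⟨ Go≡coeff (suc b′) k m ⟩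
  coeff m (∂∏ m (oddFactor (suc b′) m) (oddMarked (suc b′) k m))
    ≡⟨ coeff-≈ ≤-refl (∂∏-odd b′ k) ⟩
  coeff m (scalar (suc b′) ⊗ (oddMultiples k m ⊗ oddGF (suc b′) m))
    ≡⟨ ∑-scalar⊗ (suc b′) _ _ ⟩
  suc b′ * coeff m (oddMultiples k m ⊗ oddGF (suc b′) m)
    ≡⟨ cong (suc b′ *_) (coeff-≈ ≤-refl (≈-sym (⊗-cong
         (oddMultiples-truncate k n m m≤n (≤-trans (m≤j⇒m<1+2j ≤-refl)
           (subst (suc (2 * m) ≤_) (*-comm (suc (2 * m)) k) (m≤m*n′ (suc (2 * m)) k 1≤k))))
         (oddGF-truncate (suc b′) m≤n)))) ⟩
  suc b′ * coeff m (oddMultiples k n ⊗ oddGF (suc b′) n) ∎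
  where open ≡-Reasoning

module _ {n : ℕ} (k : ℕ) (1≤k : 1 ≤ k) where
  oddMultiples-unfold : oddMultiples k n ≈[ n ] q^ k ++ q^ (k + k) ⊗ oddMultiples k n
  oddMultiples-unfold =
    oddMultiples k n
      ≈⟨ ≈-sym (oddMultiples-truncate k (suc n) n (n≤1+n n)
           (≤-trans (m≤j⇒m<1+2j ≤-refl) (subst (suc (2 * n) ≤_) (*-comm (suc (2 * n)) k) (m≤m*n′ _ k 1≤k)))) ⟩
    q^ (k * 1) ++ ∑ₚ n (λ j → q^ (k * suc (2 * suc j)))
      ≈⟨ ++-cong (≡⇒≈ (cong q^_ (*-identityʳ k)))
                 (∑ₚ-cong n (λ j → ≈-trans (≡⇒≈ (cong q^_ (next-odd k j))) (q^-+ (k + k) _))) ⟩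
    q^ k ++ ∑ₚ n (λ j → q^ (k + k) ⊗ q^ (k * suc (2 * j)))
      ≈⟨ ++-cong ≈-refl (∑ₚ-⊗ˡ n (q^ (k + k)) _) ⟩
    q^ k ++ q^ (k + k) ⊗ oddMultiples k n ∎≈
    where
    next-odd : ∀ k j → k * suc (2 * suc j) ≡ (k + k) + k * suc (2 * j)
    next-odd = solve-∀

  -- q^k/(1 - q^{2k}) · (1 + q^k) = q^k/(1 - q^k)
  oddMultiples-⊗-1+q^ : oddMultiples k n ⊗ 1+q^ k ≈[ n ] q^ k ⊗ (one ++ oddMultiples k n ⊗ 1+q^ k)
  oddMultiples-⊗-1+q^ =
    Z ⊗ (one ++ q^ k)
      ≈⟨ ⊗-distribˡ-++ Z one (q^ k) ⟩
    Z ⊗ one ++ Z ⊗ q^ k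
      ≈⟨ ++-cong (≈-trans (⊗-identityʳ Z) oddMultiples-unfold) (⊗-comm Z (q^ k)) ⟩
    (q^ k ++ q^ (k + k) ⊗ Z) ++ q^ k ⊗ Z
      ≈⟨ ++-assoc (q^ k) (q^ (k + k) ⊗ Z) (q^ k ⊗ Z) ⟩
    q^ k ++ (q^ (k + k) ⊗ Z ++ q^ k ⊗ Z)
      ≈⟨ ++-cong (≈-sym (⊗-identityʳ (q^ k))) (++-comm (q^ (k + k) ⊗ Z) (q^ k ⊗ Z)) ⟩
    q^ k ⊗ one ++ (q^ k ⊗ Z ++ q^ (k + k) ⊗ Z)
      ≈⟨ ++-cong {P = q^ k ⊗ one} ≈-refl (++-cong {P = q^ k ⊗ Z} ≈-refl
           (≈-trans (⊗-congˡ Z (q^-+ k k)) (⊗-assoc (q^ k) (q^ k) Z))) ⟩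
    q^ k ⊗ one ++ (q^ k ⊗ Z ++ q^ k ⊗ (q^ k ⊗ Z))
      ≈⟨ ++-cong ≈-refl (≈-sym (⊗-distribˡ-++ (q^ k) Z (q^ k ⊗ Z))) ⟩
    q^ k ⊗ one ++ q^ k ⊗ (Z ++ q^ k ⊗ Z)
      ≈⟨ ≈-sym (⊗-distribˡ-++ (q^ k) one (Z ++ q^ k ⊗ Z)) ⟩
    q^ k ⊗ (one ++ (Z ++ q^ k ⊗ Z))
      ≈⟨ ⊗-congʳ (q^ k) (++-cong {P = one} ≈-refl
           (≈-sym (++-cong {P = Z ⊗ one} {Q = Z ⊗ q^ k} (⊗-identityʳ Z) (⊗-comm Z (q^ k))))) ⟩
    q^ k ⊗ (one ++ (Z ⊗ one ++ Z ⊗ q^ k))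
      ≈⟨ ⊗-congʳ (q^ k) (++-cong ≈-refl (≈-sym (⊗-distribˡ-++ Z one (q^ k)))) ⟩
    q^ k ⊗ (one ++ Z ⊗ (one ++ q^ k)) ∎≈
    where
    Z = oddMultiples k n

  oddMultiples-⊗-1+q^-⊗ : ∀ R →
    oddMultiples k n ⊗ (1+q^ k ⊗ R) ≈[ n ] q^ k ⊗ (R ++ oddMultiples k n ⊗ (1+q^ k ⊗ R))
  oddMultiples-⊗-1+q^-⊗ R =
    Z ⊗ (1+q^ k ⊗ R)                      ≈⟨ ≈-sym (⊗-assoc Z (1+q^ k) R) ⟩
    (Z ⊗ 1+q^ k) ⊗ R                      ≈⟨ ⊗-congˡ R oddMultiples-⊗-1+q^ ⟩
    (q^ k ⊗ (one ++ Z ⊗ 1+q^ k)) ⊗ R      ≈⟨ ⊗-assoc (q^ k) _ R ⟩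
    q^ k ⊗ ((one ++ Z ⊗ 1+q^ k) ⊗ R)      ≈⟨ ⊗-congʳ (q^ k) (⊗-distribʳ-++ one (Z ⊗ 1+q^ k) R) ⟩
    q^ k ⊗ (one ⊗ R ++ (Z ⊗ 1+q^ k) ⊗ R)  ≈⟨ ⊗-congʳ (q^ k) (++-cong (⊗-identityˡ R) (⊗-assoc Z (1+q^ k) R)) ⟩
    q^ k ⊗ (R ++ Z ⊗ (1+q^ k ⊗ R))        ∎≈
    where
    Z = oddMultiples k n

ind-⌊≟⌋-refl : ∀ a → ind ⌊ a ≟ a ⌋ ≡ 1
ind-⌊≟⌋-refl a with a ≟ a
... | yes _ = refl
... | no a≢a = ⊥-elim (a≢a refl)

ind-⌊≟⌋-≢ : ∀ {a b} → a ≢ b → ind ⌊ a ≟ b ⌋ ≡ 0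
ind-⌊≟⌋-≢ {a} {b} a≢b with a ≟ b
... | yes a≡b = ⊥-elim (a≢b a≡b)
... | no _    = refl

module _ {N : ℕ} where
  distinctMarked-vanish : ∀ b k i → suc i ≢ k → distinctMarked b k i ≈[ N ] []
  distinctMarked-vanish b k i 1+i≢k rewrite ind-⌊≟⌋-≢ 1+i≢k = ∂∏-zero b _ _ (λ _ _ → ≈-refl)

  distinctMarked-self : ∀ b′ k₀ →
    distinctMarked (suc b′) (suc k₀) k₀ ≈[ N ] scalar (suc b′) ⊗ (q^ suc k₀ ⊗ pow (1+q^ suc k₀) b′)
  distinctMarked-self b′ k₀ rewrite ind-⌊≟⌋-refl (suc k₀) = ∂∏-const b′ (1+q^ suc k₀) (q^ suc k₀)

distinct-factorisation : ∀ b′ k₀ n → k₀ < n → Σ Poly λ R →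
  (distinctGF (suc b′) n ≈[ n ] 1+q^ suc k₀ ⊗ R) ×
  (∂∏ n (distinctFactor (suc b′)) (distinctMarked (suc b′) (suc k₀)) ≈[ n ] scalar (suc b′) ⊗ (q^ suc k₀ ⊗ R))
distinct-factorisation b′ k₀ n k₀<n
  with R , ∏≈ , ∂∏≈ ← ∂∏-concentrated n (distinctFactor (suc b′)) (distinctMarked (suc b′) (suc k₀)) k₀ k₀<n
                        (λ i i≢k₀ → distinctMarked-vanish (suc b′) (suc k₀) i (i≢k₀ ∘ suc-injective))
  = W ⊗ R , ≈-trans ∏≈ (⊗-assoc (1+q^ k) W R) ,
    (∂∏ n (distinctFactor b) (distinctMarked b k) ≈⟨ ∂∏≈ ⟩
     distinctMarked b k k₀ ⊗ R                   ≈⟨ ⊗-congˡ R (distinctMarked-self b′ k₀) ⟩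
     (scalar b ⊗ (q^ k ⊗ W)) ⊗ R                 ≈⟨ ⊗-assoc (scalar b) (q^ k ⊗ W) R ⟩
     scalar b ⊗ ((q^ k ⊗ W) ⊗ R)                 ≈⟨ ⊗-congʳ (scalar b) (⊗-assoc (q^ k) W R) ⟩
     scalar b ⊗ (q^ k ⊗ (W ⊗ R))                 ∎≈)
  where
  b k : ℕ
  b = suc b′
  k = suc k₀
  W = pow (1+q^ k) b′

module _ (b′ k₀ n : ℕ) where
  private
    b k : ℕ
    b = suc b′
    k = suc k₀

  Go-recurrence : k ≤ n → Go b k n ≡ Fd b k n + Go b k (n ∸ k)
  Go-recurrence k≤n with R , ∏≈ , ∂∏≈ ← distinct-factorisation b′ k₀ n k≤n = begin
    Go b k n
      ≡⟨ Go≡b*coeff b′ k n n (s≤s z≤n) ≤-refl ⟩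
    b * coeff n (Z ⊗ O)
      ≡⟨ cong (b *_) (coeff-≈ ≤-refl ZO≈) ⟩
    b * coeff n (q^ k ⊗ (R ++ Z ⊗ O))
      ≡⟨ cong (b *_) (trans (coeff-q^⊗ k _ k≤n) (∑-++ R _ _)) ⟩
    b * (coeff (n ∸ k) R + coeff (n ∸ k) (Z ⊗ O))
      ≡⟨ *-distribˡ-+ b (coeff (n ∸ k) R) _ ⟩
    b * coeff (n ∸ k) R + b * coeff (n ∸ k) (Z ⊗ O)
      ≡⟨ cong₂ _+_ Fd≡ (Go≡b*coeff b′ k n (n ∸ k) (s≤s z≤n) (m∸n≤m n k)) ⟨
    Fd b k n + Go b k (n ∸ k) ∎
    where
    open ≡-Reasoning
    Z O : Poly
    Z = oddMultiples k n
    O = oddGF b n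
    O≈ : O ≈[ n ] 1+q^ k ⊗ R
    O≈ = ≈-trans (≈-sym (euler b n)) ∏≈
    ZO≈ : Z ⊗ O ≈[ n ] q^ k ⊗ (R ++ Z ⊗ O)
    ZO≈ =
      Z ⊗ O                                ≈⟨ ⊗-congʳ Z O≈ ⟩
      Z ⊗ (1+q^ k ⊗ R)                     ≈⟨ oddMultiples-⊗-1+q^-⊗ k (s≤s z≤n) R ⟩
      q^ k ⊗ (R ++ Z ⊗ (1+q^ k ⊗ R))       ≈⟨ ⊗-congʳ (q^ k) (++-cong ≈-refl (⊗-congʳ Z (≈-sym O≈))) ⟩
      q^ k ⊗ (R ++ Z ⊗ O)                  ∎≈
    Fd≡ : Fd b k n ≡ b * coeff (n ∸ k) R
    Fd≡ = begin
      Fd b k n                                                 ≡⟨ Fd≡coeff b k n ⟩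
      coeff n (∂∏ n (distinctFactor b) (distinctMarked b k))   ≡⟨ coeff-≈ ≤-refl ∂∏≈ ⟩
      coeff n (scalar b ⊗ (q^ k ⊗ R))                          ≡⟨ ∑-scalar⊗ b _ _ ⟩
      b * coeff n (q^ k ⊗ R)                                   ≡⟨ cong (b *_) (coeff-q^⊗ k R k≤n) ⟩
      b * coeff (n ∸ k) R                                      ∎

  Fd-vanish : n < k → Fd b k n ≡ 0
  Fd-vanish n<k = trans (Fd≡coeff b k n) (coeff-≈ ≤-refl (∂∏-zero n _ _ small-parts))
    where
    small-parts : ∀ i → i < n → distinctMarked b k i ≈[ n ] []
    small-parts i i<n = distinctMarked-vanish b k i (λ 1+i≡k → <⇒≱ n<k (subst (_≤ n) 1+i≡k i<n))

  Go-vanish : n < k → Go b k n ≡ 0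
  Go-vanish n<k = begin
    Go b k n                                   ≡⟨ Go≡b*coeff b′ k n n (s≤s z≤n) ≤-refl ⟩
    b * coeff n (oddMultiples k n ⊗ oddGF b n)  ≡⟨ cong (b *_) (coeff-≈ ≤-refl no-multiples) ⟩
    b * 0                                      ≡⟨ *-zeroʳ b ⟩
    0                                          ∎
    where
    open ≡-Reasoning
    no-multiples : oddMultiples k n ⊗ oddGF b n ≈[ n ] []
    no-multiples = ≈-trans (⊗-congˡ _ (oddMultiples-truncate k n 0 z≤n (subst (n <_) (sym (*-identityʳ k)) n<k)))
                           (⊗-zeroˡ _)

+m-+n≡+[m∸n] : ∀ {m n} → n ≤ m → + m - + n ≡ + (m ∸ n)
+m-+n≡+[m∸n] {m} {n} n≤m = trans ([+m]-[+n]≡m⊖n m n) (⊖-≥ n≤m)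

+m-+n<0 : ∀ {m n} → m < n → + m - + n ≡ -[1+ (n ∸ suc m) ]
+m-+n<0 {m} {n} m<n = trans ([+m]-[+n]≡m⊖n m n) (trans (⊖-< m<n) (cong (λ d → - (+ d)) (+-∸-assoc 1 m<n)))

m≡n+o⇒+n≡+m-+o : ∀ {m n o} → m ≡ n + o → + n ≡ + m - + o
m≡n+o⇒+n≡+m-+o {m} {n} {o} refl = sym (trans (+m-+n≡+[m∸n] (m≤n+m o n)) (cong +_ (m+n∸n≡m n o)))

Goℤ-+ : ∀ b k m → Goℤ b k (+ m) ≡ + Go b k m
Goℤ-+ b k zero    = refl
Goℤ-+ b k (suc m) = refl

theorem5 : (b : ℕ) → 1 ≤ b → (n k : ℕ) → 1 ≤ n → 1 ≤ k →
    + Fd b k n ≡ Goℤ b k (+ n) - Goℤ b k (+ n - + k)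
theorem5 (suc b′) _ n (suc k₀) _ _ with suc k₀ ≤? n
... | yes k≤n = begin
  + Fd b k n                           ≡⟨ m≡n+o⇒+n≡+m-+o (Go-recurrence b′ k₀ n k≤n) ⟩
  + Go b k n - + Go b k (n ∸ k)        ≡⟨ cong₂ _-_ (Goℤ-+ b k n) (trans (cong (Goℤ b k) (+m-+n≡+[m∸n] k≤n))
                                                                        (Goℤ-+ b k (n ∸ k))) ⟨
  Goℤ b k (+ n) - Goℤ b k (+ n - + k)  ∎
  where
  open ≡-Reasoning
  b k : ℕ
  b = suc b′
  k = suc k₀
... | no k≰n = begin
  + Fd b k n                           ≡⟨ cong +_ (Fd-vanish b′ k₀ n n<k) ⟩
  + 0 - + 0                            ≡⟨ cong₂ _-_ (trans (Goℤ-+ b k n) (cong +_ (Go-vanish b′ k₀ n n<k)))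
                                                    (cong (Goℤ b k) (+m-+n<0 n<k)) ⟨
  Goℤ b k (+ n) - Goℤ b k (+ n - + k)  ∎
  where
  open ≡-Reasoning
  b k : ℕ
  b = suc b′
  k = suc k₀
  n<k : n < k
  n<k = ≰⇒> k≰n
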